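{- Let $a\neq0$ and $b$ be parameters and let $M^{(a,b)}(x)=\sum_{n\ge0}M^{(a,b)}_nx^n=\frac{1-ax-\sqrt{(1-ax)^2-4bx^2}}{2bx^2}$. Let $\mathcal{X}_n$ be the set of $(a,b)$-Motzkin paths of length $n$ whose first step is not an $\mathbf{h}$-step. Let $\mathcal{V}_n$ be the set of weighted Dyck paths of length $2n$ described in the context, with weight functions $\alpha(x)=ax$, $\beta(x)=\frac{b}{a}xM^{(a,b)}(x)$ and $\gamma(x)=bx^2M^{(a,b)}(x)$. Then there exists a (weight-preserving) bijection between $\mathcal{X}_n$ and $\mathcal{V}_n$.
   Context: An $(a,b)$-Motzkin path of length $n$ is a lattice path from $(0,0)$ to $(n,0)$ never going below the $x$-axis, with up steps $\mathbf{u}=(1,1)$ of weight $1$, down steps $\mathbf{d}=(1,-1)$ of weight $b$ and horizontal steps $\mathbf{h}=(1,0)$ of weight $a$; its weight is the product of its step weights, and $M^{(a,b)}_n$ is the total weight of all such paths of length $n$. A Dyck path of length $2n$ is a lattice path from $(0,0)$ to $(2n,0)$ with steps $\mathbf{u}=(1,1)$, $\mathbf{d}=(1,-1)$ never going below the $x$-axis. A valley is an occurrence of $\mathbf{du}$; its level is the ordinate of the common point of its two steps. A pyramid is a consecutive section $\mathbf{u}^h\mathbf{d}^h$ ($h\ge1$ its height); it is maximal if it cannot be extended to $\mathbf{u}^{h+1}\mathbf{d}^{h+1}$; its altitude is the ordinate of the endpoint of its last $\mathbf{d}$-step. A Dyck path is primitive if it is nonempty and touches the $x$-axis only at its endpoints.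 Given weight functions $\alpha(x)=\sum_{k\ge1}\alpha_kx^k$, $\beta(x)=\sum_{k\ge1}\beta_kx^k$, $\gamma(x)=\sum_{k\ge1}\gamma_kx^k$, let $\mathcal{A}_n$ be the set of primitive Dyck paths $P$ of length $2n$ all of whose valleys lie at the same level, weighted by: $w(\mathbf{u}^n\mathbf{d}^n)=\gamma_n$, and for $P=\mathbf{u}^k\mathbf{u}^{i_1}\mathbf{d}^{i_1}\cdots\mathbf{u}^{i_r}\mathbf{d}^{i_r}\mathbf{d}^k$ ($k\ge1$, $r\ge2$, $i_j\ge1$), $w(P)=\beta_k\alpha_{i_1}\cdots\alpha_{i_r}$; only paths of nonzero weight are kept. $\mathcal{V}_n$ is the set of Dyck paths of length $2n$ that are concatenations of zero or more paths from $\bigcup_{s\ge1}\mathcal{A}_s$, weighted by the product of the weights of the factors (empty path: weight $1$). A bijection between sets of weighted paths whose weights are polynomials with nonnegative integer coefficients in the parameters is understood in the weight-preserving sense: each path is regarded as a collection of copies, one per monomial term counted with multiplicity, and the bijection matches these copies with equal monomial weights. -}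

module Defs where

open import Data.Nat using (ℕ; zero; suc; _+_; _*_; _≤_)
open import Data.Integer as ℤ using (ℤ; +_; -[1+_])
open import Data.Product using (Σ; Σ-syntax; _×_; _,_; proj₁; proj₂; ∃)
open import Data.List using (List; []; _∷_; _++_; length; replicate; concatMap; [_])
open import Data.List.Relation.Unary.All using (All; []; _∷_)
open import Data.Empty using (⊥)
open import Data.Unit using (⊤)
open import Relation.Binary.PropositionalEquality using (_≡_; _≢_)
open import Relation.Nullary using (¬_)
open import Function.Bundles using (_↔_; Inverse)

-- Monomials a^i b^j in the formal parameters a, b.  Since β involves
-- b/a, the exponent of a is allowed to be an integer (Laurent monomial).

Mon : Set
Mon = ℤ × ℕ

_·_ : Mon → Mon → Mon
(i , j) · (k , l) = (i ℤ.+ k , j + l)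

𝟙 : Mon
𝟙 = (+ 0 , 0)

monA : Mon
monA = (+ 1 , 0)

monB : Mon
monB = (+ 0 , 1)

monB/A : Mon
monB/A = (-[1+ 0 ] , 1)

-- A weighted set whose weight is a (Laurent) polynomial with nonnegative
-- integer coefficients, presented as its collection of copies: one copy
-- per monomial term, counted with multiplicity.
record WSet : Set₁ where
  field
    Copy : Set
    mono : Copy → Mon
open WSet public

∅W : WSet
∅W = record { Copy = ⊥ ; mono = λ () }

data MStep : Set where
  U D H : MStep

data Mot : ℕ → List MStep → Set where
  end  : Mot 0 []
  up   : ∀ {h s} → Mot (suc h) s → Mot h (U ∷ s)
  down : ∀ {h s} → Mot h s → Mot (suc h) (D ∷ s)
  hor  : ∀ {h s} → Mot h s → Mot h (H ∷ s)

mweight : List MStep → Mon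
mweight []      = 𝟙
mweight (U ∷ s) = mweight s
mweight (D ∷ s) = monB · mweight s
mweight (H ∷ s) = monA · mweight s

MotzPath : ℕ → Set
MotzPath n = Σ[ s ∈ List MStep ] (length s ≡ n × Mot 0 s)

-- the weighted set of (a,b)-Motzkin paths of length n; its weight
-- polynomial is M^{(a,b)}_n
MW : ℕ → WSet
MW n = record { Copy = MotzPath n ; mono = λ p → mweight (proj₁ p) }

FirstNotH : List MStep → Set
FirstNotH (H ∷ _) = ⊥
FirstNotH _       = ⊤

𝒳 : ℕ → WSet
𝒳 n = record
  { Copy = Σ[ s ∈ List MStep ] (length s ≡ n × Mot 0 s × FirstNotH s)
  ; mono = λ p → mweight (proj₁ p) }

data DStep : Set where
  u d : DStep

data Dyk : ℕ → List DStep → Set where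
  end  : Dyk 0 []
  up   : ∀ {h s} → Dyk (suc h) s → Dyk h (u ∷ s)
  down : ∀ {h s} → Dyk h s → Dyk (suc h) (d ∷ s)

IsDyck : List DStep → Set
IsDyck = Dyk 0

height : List DStep → ℤ
height []      = + 0
height (u ∷ p) = + 1 ℤ.+ height p
height (d ∷ p) = ℤ.- (+ 1) ℤ.+ height p

Primitive : List DStep → Set
Primitive P = (P ≢ []) ×
  (∀ p q → P ≡ p ++ q → p ≢ [] → q ≢ [] → height p ≢ + 0)

SameLevelValleys : List DStep → Set
SameLevelValleys P = ∀ p q p′ q′ →
  P ≡ p ++ d ∷ u ∷ q → P ≡ p′ ++ d ∷ u ∷ q′ →
  height (p ++ [ d ]) ≡ height (p′ ++ [ d ])

-- P is a primitive Dyck path of length 2n all of whose valleys are at the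
-- same level (the Π-type predicates are irrelevant fields so that
-- paths are compared by their steps only)
record InA (n : ℕ) (P : List DStep) : Set where
  field
    len   : length P ≡ 2 * n
    dyck  : IsDyck P
    .prim : Primitive P
    .lev  : SameLevelValleys P

pyr : ℕ → List DStep
pyr h = replicate h u ++ replicate h d

-- Weight functions, given by their coefficient sequences
-- (the coefficient of x^k; index 0 is never used).
module _ (α β γ : ℕ → WSet) where

  monAll : ∀ {is} → All (λ i → Copy (α i)) is → Mon
  monAll []       = 𝟙
  monAll (c ∷ cs) = mono (α _) c · monAll cs

  -- copies of the weight w(P) of a path P ∈ 𝒜 (one per monomial term),
  -- organised according to the two shapes in the definition of w
  data ACopy (P : List DStep) : Set where
    γ-copy : (n : ℕ) → 1 ≤ n → P ≡ pyr n → Copy (γ n) → ACopy P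
    β-copy : (k : ℕ) → 1 ≤ k → (is : List ℕ) → 2 ≤ length is →
             All (1 ≤_) is →
             P ≡ replicate k u ++ concatMap pyr is ++ replicate k d →
             Copy (β k) → All (λ i → Copy (α i)) is → ACopy P

  aMono : ∀ {P} → ACopy P → Mon
  aMono (γ-copy n _ _ c)           = mono (γ n) c
  aMono (β-copy k _ _ _ _ _ c cs) = mono (β k) c · monAll cs

  AFactor : Set
  AFactor = Σ[ s ∈ ℕ ] Σ[ P ∈ List DStep ] (InA s P × ACopy P)

  factorPath : AFactor → List DStep
  factorPath (_ , P , _) = P

  factorMono : AFactor → Mon
  factorMono (_ , _ , _ , c) = aMono c

  monFactors : List AFactor → Mon
  monFactors []       = 𝟙
  monFactors (f ∷ fs) = factorMono f · monFactors fs

  𝒱 : ℕ → WSet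
  𝒱 n = record
    { Copy = Σ[ Q ∈ List DStep ] (length Q ≡ 2 * n × IsDyck Q ×
               Σ[ fs ∈ List AFactor ] Q ≡ concatMap factorPath fs)
    ; mono = λ { (_ , _ , _ , fs , _) → monFactors fs } }

αW : ℕ → WSet
αW i = record { Copy = i ≡ 1 ; mono = λ _ → monA }

-- β(x) = (b/a) x M^{(a,b)}(x) : β_{m+1} = (b/a) M_m
βW : ℕ → WSet
βW zero    = ∅W
βW (suc m) = record { Copy = Copy (MW m) ; mono = λ c → monB/A · mono (MW m) c }

-- γ(x) = b x² M^{(a,b)}(x) : γ_{m+2} = b M_m, γ_0 = γ_1 = 0
γW : ℕ → WSet
γW zero          = ∅W
γW (suc zero)    = ∅W
γW (suc (suc m)) = record { Copy = Copy (MW m) ; mono = λ c → monB · mono (MW m) c }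

_≅W_ : WSet → WSet → Set
X ≅W Y = Σ[ f ∈ Copy X ↔ Copy Y ] (∀ x → mono Y (Inverse.to f x) ≡ mono X x)

-- A Motzkin path whose first step is not h factors uniquely (first-return
-- decomposition, then peeling off the h-steps that follow each return) into
-- arches u·p·d·hʲ with p a Motzkin path of length m, of weight b·w(p)·aʲ.
-- Such an arch is sent to a single factor of 𝒱: for j = 0 the pyramid
-- u^{m+2}d^{m+2}, weighted by γ_{m+2} = b·M_m, and for j ≥ 1 the path
-- u^{m+1}(ud)^{j+1}d^{m+1}, weighted by β_{m+1}·α_1^{j+1} = (b/a)·M_m·a^{j+1}.
-- Half-lengths and weights agree, and concatenation is respected.
module Submission where

open import Defs
open import Data.Nat using (ℕ; zero; suc; _+_; _*_; _≤_; z≤n; s≤s)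
open import Data.Nat.Properties
open import Data.Integer as ℤ using (+_)
import Data.Integer.Properties as ℤP
open import Data.Product using (Σ; ∃-syntax; _×_; _,_; proj₁; proj₂)
open import Data.List using (List; []; _∷_; _++_; length; replicate; concatMap; [_])
open import Data.List.Properties using (length-++; length-++-≤ʳ; ++-assoc; length-replicate; ∷-injectiveʳ; ∷-injectiveˡ)
open import Data.List.Relation.Unary.All as All using (All; []; _∷_)
open import Data.Empty using (⊥-elim)
open import Data.Unit using (tt)
open import Function using (_∘_)
open import Function.Bundles using (mk↔ₛ′)
open import Relation.Binary.PropositionalEquality hiding ([_])
import Data.Nat.Tactic.RingSolver as ℕ-Solver
import Data.Integer.Tactic.RingSolver as ℤ-Solver

init-prefix : ∀ {A : Set} (R p q : List A) {x : A} →
  R ++ [ x ] ≡ p ++ q → q ≢ [] → ∃[ r ] R ≡ p ++ r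
init-prefix R [] q eq q≢[] = R , refl
init-prefix [] (y ∷ []) [] eq q≢[] = ⊥-elim (q≢[] refl)
init-prefix [] (y ∷ []) (_ ∷ _) ()
init-prefix [] (y ∷ _ ∷ _) q ()
init-prefix (z ∷ R) (y ∷ p) q eq q≢[] with init-prefix R p q (∷-injectiveʳ eq) q≢[] | ∷-injectiveˡ eq
... | r , e | refl = r , cong (y ∷_) e

zigzag : ℕ → List DStep
zigzag r = concatMap pyr (replicate r 1)

wrap : ℕ → List DStep → List DStep
wrap k X = replicate k u ++ X ++ replicate k d

plateau : ℕ → ℕ → List DStep
plateau k r = wrap k (zigzag r)

Dyk-irrelevant : ∀ {h s} (p q : Dyk h s) → p ≡ q
Dyk-irrelevant end end = refl
Dyk-irrelevant (up p) (up q) = cong up (Dyk-irrelevant p q)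
Dyk-irrelevant (down p) (down q) = cong down (Dyk-irrelevant p q)

Dyk-++ : ∀ {h P Q} → Dyk h P → Dyk 0 Q → Dyk h (P ++ Q)
Dyk-++ end DQ = DQ
Dyk-++ (up DP) DQ = up (Dyk-++ DP DQ)
Dyk-++ (down DP) DQ = down (Dyk-++ DP DQ)

Dyk-ups : ∀ k {h X} → Dyk (k + h) X → Dyk h (replicate k u ++ X)
Dyk-ups zero DX = DX
Dyk-ups (suc k) {h} {X} DX = up (Dyk-ups k (subst (λ i → Dyk i X) (sym (+-suc k h)) DX))

Dyk-descent : ∀ k → Dyk k (replicate k d)
Dyk-descent zero = end
Dyk-descent (suc k) = down (Dyk-descent k)

Dyk-zigzag : ∀ r {h Y} → Dyk h Y → Dyk h (zigzag r ++ Y)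
Dyk-zigzag zero DY = DY
Dyk-zigzag (suc r) DY = up (down (Dyk-zigzag r DY))

Dyk-wrap : ∀ k {X} → Dyk k (X ++ replicate k d) → Dyk 0 (wrap k X)
Dyk-wrap k {X} DX = Dyk-ups k (subst (λ i → Dyk i (X ++ replicate k d)) (sym (+-identityʳ k)) DX)

pyr-Dyck : ∀ n → IsDyck (pyr n)
pyr-Dyck n = Dyk-wrap n (Dyk-descent n)

plateau-Dyck : ∀ k r → IsDyck (plateau k r)
plateau-Dyck k r = Dyk-wrap k (Dyk-zigzag r (Dyk-descent k))

length-zigzag : ∀ r → length (zigzag r) ≡ 2 * r
length-zigzag zero = refl
length-zigzag (suc r) = trans (cong (suc ∘ suc) (length-zigzag r)) (sym (*-suc 2 r))

length-wrap : ∀ k X → length (wrap k X) ≡ 2 * k + length X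
length-wrap k X = begin
  length (replicate k u ++ X ++ replicate k d)
    ≡⟨ length-++ (replicate k u) ⟩
  length (replicate k u) + length (X ++ replicate k d)
    ≡⟨ cong₂ _+_ (length-replicate k) (length-++ X) ⟩
  k + (length X + length (replicate k d))
    ≡⟨ cong (λ z → k + (length X + z)) (length-replicate k) ⟩
  k + (length X + k)
    ≡⟨ rearrange k (length X) ⟩
  2 * k + length X ∎
  where
  open ≡-Reasoning
  rearrange : ∀ k l → k + (l + k) ≡ 2 * k + l
  rearrange = ℕ-Solver.solve-∀

length-pyr : ∀ n → length (pyr n) ≡ 2 * n
length-pyr n = trans (length-wrap n []) (+-identityʳ (2 * n))

length-plateau : ∀ k r → length (plateau k r) ≡ 2 * (k + r)
length-plateau k r = begin
  length (wrap k (zigzag r))  ≡⟨ length-wrap k (zigzag r) ⟩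
  2 * k + length (zigzag r)   ≡⟨ cong (_+_ (2 * k)) (length-zigzag r) ⟩
  2 * k + 2 * r               ≡⟨ sym (*-distribˡ-+ 2 k r) ⟩
  2 * (k + r) ∎
  where open ≡-Reasoning

height-ups : ∀ k X → height (replicate k u ++ X) ≡ + k ℤ.+ height X
height-ups zero X = sym (ℤP.+-identityˡ (height X))
height-ups (suc k) X =
  trans (cong (ℤ._+_ (+ 1)) (height-ups k X)) (sym (ℤP.+-assoc (+ 1) (+ k) (height X)))

Dyk-prefix-height : ∀ {h} p r → Dyk h (p ++ r) → ∃[ h′ ] + h ℤ.+ height p ≡ + h′
Dyk-prefix-height {h} [] r DP = h , ℤP.+-identityʳ (+ h)
Dyk-prefix-height {h} (u ∷ p) r (up DP) with Dyk-prefix-height p r DP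
... | h′ , e = h′ , trans (step (+ h) (height p)) e
  where
  step : ∀ a x → a ℤ.+ (+ 1 ℤ.+ x) ≡ (+ 1 ℤ.+ a) ℤ.+ x
  step = ℤ-Solver.solve-∀
Dyk-prefix-height {suc h} (d ∷ p) r (down DP) with Dyk-prefix-height p r DP
... | h′ , e = h′ , trans (step (+ h) (height p)) e
  where
  step : ∀ a x → (+ 1 ℤ.+ a) ℤ.+ (ℤ.- (+ 1) ℤ.+ x) ≡ a ℤ.+ x
  step = ℤ-Solver.solve-∀

-- A nonempty proper prefix of u·R·d is u·p with p a prefix of R, so its
-- height is 1 + height p ≥ 1.
elevate-primitive : ∀ R → IsDyck R → Primitive (u ∷ R ++ [ d ])
elevate-primitive R DR = (λ ()) , no-return
  where
  no-return : ∀ p q → u ∷ R ++ [ d ] ≡ p ++ q → p ≢ [] → q ≢ [] → height p ≢ + 0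
  no-return [] q eq p≢[] q≢[] = ⊥-elim (p≢[] refl)
  no-return (x ∷ p) q eq p≢[] q≢[] hp≡0
    with ∷-injectiveˡ eq | init-prefix R p q (∷-injectiveʳ eq) q≢[]
  ... | refl | r , refl with Dyk-prefix-height p r DR
  ... | h , e with trans (sym (cong (ℤ._+_ (+ 1)) (trans (sym (ℤP.+-identityˡ (height p))) e))) hp≡0
  ... | ()

wrap-suc : ∀ k X → wrap (suc k) X ≡ u ∷ wrap k X ++ [ d ]
wrap-suc k X = cong (u ∷_) (begin
  replicate k u ++ X ++ d ∷ replicate k d
    ≡⟨ cong (λ z → replicate k u ++ X ++ z) (d∷≡∷ʳd k) ⟩
  replicate k u ++ X ++ replicate k d ++ [ d ]
    ≡⟨ cong (replicate k u ++_) (sym (++-assoc X (replicate k d) [ d ])) ⟩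
  replicate k u ++ (X ++ replicate k d) ++ [ d ]
    ≡⟨ sym (++-assoc (replicate k u) (X ++ replicate k d) [ d ]) ⟩
  wrap k X ++ [ d ] ∎)
  where
  open ≡-Reasoning
  d∷≡∷ʳd : ∀ k → d ∷ replicate k d ≡ replicate k d ++ [ d ]
  d∷≡∷ʳd zero = refl
  d∷≡∷ʳd (suc k) = cong (d ∷_) (d∷≡∷ʳd k)

wrap-suc-primitive : ∀ k X → IsDyck (wrap k X) → Primitive (wrap (suc k) X)
wrap-suc-primitive k X DX = subst Primitive (sym (wrap-suc k X)) (elevate-primitive (wrap k X) DX)

ups-valley-split : ∀ k X p {q} → p ++ d ∷ u ∷ q ≡ replicate k u ++ X →
  ∃[ p′ ] p ≡ replicate k u ++ p′ × p′ ++ d ∷ u ∷ q ≡ X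
ups-valley-split zero X p eq = p , refl , eq
ups-valley-split (suc k) X [] ()
ups-valley-split (suc k) X (x ∷ p) eq with ∷-injectiveˡ eq | ups-valley-split k X p (∷-injectiveʳ eq)
... | refl | p′ , e₁ , e₂ = p′ , cong (u ∷_) e₁ , e₂

descent-valley-free : ∀ k p {q} → p ++ d ∷ u ∷ q ≢ replicate k d
descent-valley-free zero [] ()
descent-valley-free zero (x ∷ p) ()
descent-valley-free (suc zero) [] ()
descent-valley-free (suc (suc k)) [] ()
descent-valley-free (suc k) (x ∷ p) eq = descent-valley-free k p (∷-injectiveʳ eq)

zigzag-valley-level : ∀ r k p {q} → p ++ d ∷ u ∷ q ≡ zigzag r ++ replicate k d →
  height (p ++ [ d ]) ≡ + 0
zigzag-valley-level zero k p eq = ⊥-elim (descent-valley-free k p eq)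
zigzag-valley-level (suc r) k [] ()
zigzag-valley-level (suc r) k (d ∷ p) ()
zigzag-valley-level (suc r) k (u ∷ []) eq = refl
zigzag-valley-level (suc r) k (u ∷ u ∷ p) ()
zigzag-valley-level (suc r) k (u ∷ d ∷ p) eq =
  cong (λ z → + 1 ℤ.+ (ℤ.- (+ 1) ℤ.+ z))
       (zigzag-valley-level r k p (∷-injectiveʳ (∷-injectiveʳ eq)))

plateau-valley-level : ∀ k r p {q} → plateau k r ≡ p ++ d ∷ u ∷ q → height (p ++ [ d ]) ≡ + k
plateau-valley-level k r p e with ups-valley-split k (zigzag r ++ replicate k d) p (sym e)
... | p₀ , refl , e₀ = begin
  height ((replicate k u ++ p₀) ++ [ d ])  ≡⟨ cong height (++-assoc (replicate k u) p₀ [ d ]) ⟩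
  height (replicate k u ++ p₀ ++ [ d ])    ≡⟨ height-ups k (p₀ ++ [ d ]) ⟩
  + k ℤ.+ height (p₀ ++ [ d ])             ≡⟨ cong (ℤ._+_ (+ k)) (zigzag-valley-level r k p₀ e₀) ⟩
  + k ℤ.+ + 0                              ≡⟨ ℤP.+-identityʳ (+ k) ⟩
  + k ∎
  where open ≡-Reasoning

plateau-sameLevelValleys : ∀ k r → SameLevelValleys (plateau k r)
plateau-sameLevelValleys k r p q p′ q′ e e′ =
  trans (plateau-valley-level k r p e) (sym (plateau-valley-level k r p′ e′))

pyr-sameLevelValleys : ∀ n → SameLevelValleys (pyr n)
pyr-sameLevelValleys n p q p′ q′ e e′ with ups-valley-split n (replicate n d) p (sym e)
... | p₀ , _ , e₀ = ⊥-elim (descent-valley-free n p₀ e₀)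

pyr-InA : ∀ n → InA (suc n) (pyr (suc n))
pyr-InA n = record
  { len  = length-pyr (suc n)
  ; dyck = pyr-Dyck (suc n)
  ; prim = wrap-suc-primitive n [] (pyr-Dyck n)
  ; lev  = pyr-sameLevelValleys (suc n)
  }

plateau-InA : ∀ k r → InA (suc k + r) (plateau (suc k) r)
plateau-InA k r = record
  { len  = length-plateau (suc k) r
  ; dyck = plateau-Dyck (suc k) r
  ; prim = wrap-suc-primitive k (zigzag r) (plateau-Dyck k r)
  ; lev  = plateau-sameLevelValleys (suc k) r
  }

InA-irrelevant : ∀ {n P} (A A′ : InA n P) → A ≡ A′
InA-irrelevant record { len = l ; dyck = DP } record { len = l′ ; dyck = DP′ }
  with ≡-irrelevant l l′ | Dyk-irrelevant DP DP′
... | refl | refl = refl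

VFactor : Set
VFactor = AFactor αW βW γW

record Arch : Set where
  constructor arch
  field
    inner     : List MStep
    inner-Mot : Mot 0 inner
    flats     : ℕ

archWord : Arch → List MStep
archWord (arch p _ j) = U ∷ p ++ D ∷ replicate j H

ones : ∀ r → All (_≡ 1) (replicate r 1)
ones zero = []
ones (suc r) = refl ∷ ones r

ones-positive : ∀ r → All (1 ≤_) (replicate r 1)
ones-positive zero = []
ones-positive (suc r) = s≤s z≤n ∷ ones-positive r

fromArch : Arch → VFactor
fromArch (arch p M zero) =
  suc (suc (length p)) , pyr (suc (suc (length p))) , pyr-InA (suc (length p)) ,
  γ-copy (suc (suc (length p))) (s≤s z≤n) refl (p , refl , M)
fromArch (arch p M (suc j)) =
  suc (length p) + suc (suc j) , plateau (suc (length p)) (suc (suc j)) ,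
  plateau-InA (length p) (suc (suc j)) ,
  β-copy (suc (length p)) (s≤s z≤n) (replicate (suc (suc j)) 1) (s≤s (s≤s z≤n))
         (ones-positive (suc (suc j))) refl (p , refl , M) (ones (suc (suc j)))

-- γW 0, γW 1 and βW 0 are empty, and a β-factor has at least two peaks.
toArch : VFactor → Arch
toArch (_ , _ , _ , γ-copy zero _ _ ())
toArch (_ , _ , _ , γ-copy (suc zero) _ _ ())
toArch (_ , _ , _ , γ-copy (suc (suc m)) _ _ (p , _ , M)) = arch p M 0
toArch (_ , _ , _ , β-copy zero _ _ _ _ _ () _)
toArch (_ , _ , _ , β-copy (suc m) _ [] () _ _ _ _)
toArch (_ , _ , _ , β-copy (suc m) _ (_ ∷ []) (s≤s ()) _ _ _ _)
toArch (_ , _ , _ , β-copy (suc m) _ (_ ∷ _ ∷ is) _ _ _ (p , _ , M) _) = arch p M (suc (length is))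

toArch-fromArch : ∀ a → toArch (fromArch a) ≡ a
toArch-fromArch (arch p M zero) = refl
toArch-fromArch (arch p M (suc j)) = cong (λ z → arch p M (suc z)) (length-replicate j)

ones-unique : ∀ is (cs : All (_≡ 1) is) →
  _≡_ {A = Σ (List ℕ) (All (_≡ 1))} (is , cs) (replicate (length is) 1 , ones (length is))
ones-unique [] [] = refl
ones-unique (.1 ∷ is) (refl ∷ cs) = cong (λ { (is′ , cs′) → 1 ∷ is′ , refl ∷ cs′ }) (ones-unique is cs)

-- The size index of a factor is forced by the length of its path; all else is proof-irrelevant.
pyr-factor-unique : ∀ n s (A : InA s (pyr n)) (A′ : InA n (pyr n)) (c : Copy (γW n)) (p p′ : 1 ≤ n) →
  _≡_ {A = VFactor} (n , pyr n , A′ , γ-copy n p′ refl c) (s , pyr n , A , γ-copy n p refl c)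
pyr-factor-unique n s A A′ c p p′ with *-cancelˡ-≡ n s 2 (trans (sym (length-pyr n)) (InA.len A))
... | refl rewrite ≤-irrelevant p p′ | InA-irrelevant A A′ = refl

plateau-factor-unique : ∀ k r (ic : Σ (List ℕ) (All (_≡ 1))) → ic ≡ (replicate r 1 , ones r) →
  ∀ s (A : InA s (wrap k (concatMap pyr (proj₁ ic)))) p q pos c
  (A′ : InA (k + r) (plateau k r)) q′ pos′ →
  _≡_ {A = VFactor} (k + r , plateau k r , A′ , β-copy k p (replicate r 1) q′ pos′ refl c (ones r))
                    (s , _ , A , β-copy k p (proj₁ ic) q pos refl c (proj₂ ic))
plateau-factor-unique k r .(replicate r 1 , ones r) refl s A p q pos c A′ q′ pos′
  with *-cancelˡ-≡ (k + r) s 2 (trans (sym (length-plateau k r)) (InA.len A))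
... | refl rewrite ≤-irrelevant q q′ | All.irrelevant ≤-irrelevant pos pos′ | InA-irrelevant A A′ = refl

fromArch-toArch : ∀ f → fromArch (toArch f) ≡ f
fromArch-toArch (_ , _ , _ , γ-copy zero _ _ ())
fromArch-toArch (_ , _ , _ , γ-copy (suc zero) _ _ ())
fromArch-toArch (s , _ , A , γ-copy (suc (suc .(length p))) q refl (p , refl , M)) =
  pyr-factor-unique (suc (suc (length p))) s A _ (p , refl , M) q (s≤s z≤n)
fromArch-toArch (_ , _ , _ , β-copy zero _ _ _ _ _ () _)
fromArch-toArch (_ , _ , _ , β-copy (suc m) _ [] () _ _ _ _)
fromArch-toArch (_ , _ , _ , β-copy (suc m) _ (_ ∷ []) (s≤s ()) _ _ _ _)
fromArch-toArch (s , _ , A , β-copy (suc .(length p)) (s≤s z≤n) (.1 ∷ .1 ∷ is) q pos refl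
                                      (p , refl , M) (refl ∷ refl ∷ cs)) =
  plateau-factor-unique (suc (length p)) (suc (suc (length is))) (1 ∷ 1 ∷ is , refl ∷ refl ∷ cs)
    (cong (λ { (is′ , cs′) → 1 ∷ 1 ∷ is′ , refl ∷ refl ∷ cs′ }) (ones-unique is cs))
    s A (s≤s z≤n) q pos (p , refl , M) _ _ _

arches : List VFactor → List MStep
arches = concatMap (archWord ∘ toArch)

factorsPath : List VFactor → List DStep
factorsPath = concatMap (factorPath αW βW γW)

Mot-irrelevant : ∀ {h s} (M M′ : Mot h s) → M ≡ M′
Mot-irrelevant end end = refl
Mot-irrelevant (up M) (up M′) = cong up (Mot-irrelevant M M′)
Mot-irrelevant (down M) (down M′) = cong down (Mot-irrelevant M M′)
Mot-irrelevant (hor M) (hor M′) = cong hor (Mot-irrelevant M M′)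

Mot-++ : ∀ {h s t} → Mot h s → Mot 0 t → Mot h (s ++ t)
Mot-++ end M = M
Mot-++ (up M) M′ = up (Mot-++ M M′)
Mot-++ (down M) M′ = down (Mot-++ M M′)
Mot-++ (hor M) M′ = hor (Mot-++ M M′)

Mot-flats : ∀ j → Mot 0 (replicate j H)
Mot-flats zero = end
Mot-flats (suc j) = hor (Mot-flats j)

Mot-return : ∀ {h s t} → Mot h s → Mot 0 t → Mot (suc h) (s ++ D ∷ t)
Mot-return end M′ = down M′
Mot-return (up M) M′ = up (Mot-return M M′)
Mot-return (down M) M′ = down (Mot-return M M′)
Mot-return (hor M) M′ = hor (Mot-return M M′)

archWord-Mot : ∀ a → Mot 0 (archWord a)
archWord-Mot (arch p M j) = up (Mot-return M (Mot-flats j))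

arches-Mot : ∀ fs → Mot 0 (arches fs)
arches-Mot [] = end
arches-Mot (f ∷ fs) = Mot-++ (archWord-Mot (toArch f)) (arches-Mot fs)

FirstNotH-irrelevant : ∀ s (x y : FirstNotH s) → x ≡ y
FirstNotH-irrelevant [] tt tt = refl
FirstNotH-irrelevant (U ∷ s) tt tt = refl
FirstNotH-irrelevant (D ∷ s) tt tt = refl

arches-FirstNotH : ∀ fs → FirstNotH (arches fs)
arches-FirstNotH [] = tt
arches-FirstNotH (f ∷ fs) = tt

archWord-length : ∀ a → 2 * length (archWord a) ≡ length (factorPath αW βW γW (fromArch a))
archWord-length (arch p M zero) = begin
  2 * suc (length (p ++ [ D ]))  ≡⟨ cong (λ z → 2 * suc z) (length-++ p) ⟩
  2 * suc (length p + 1)         ≡⟨ cong (λ z → 2 * suc z) (+-comm (length p) 1) ⟩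
  2 * suc (suc (length p))       ≡⟨ sym (length-pyr (suc (suc (length p)))) ⟩
  length (pyr (suc (suc (length p)))) ∎
  where open ≡-Reasoning
archWord-length (arch p M (suc j)) = begin
  2 * suc (length (p ++ D ∷ replicate (suc j) H))
    ≡⟨ cong (λ z → 2 * suc z) (length-++ p) ⟩
  2 * suc (length p + suc (suc (length (replicate j H))))
    ≡⟨ cong (λ z → 2 * suc (length p + suc (suc z))) (length-replicate j) ⟩
  2 * (suc (length p) + suc (suc j))
    ≡⟨ sym (length-plateau (suc (length p)) (suc (suc j))) ⟩
  length (plateau (suc (length p)) (suc (suc j))) ∎
  where open ≡-Reasoning

factor-length : ∀ f → 2 * length (archWord (toArch f)) ≡ length (factorPath αW βW γW f)
factor-length f =
  trans (archWord-length (toArch f)) (cong (length ∘ factorPath αW βW γW) (fromArch-toArch f))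

arches-length : ∀ fs → 2 * length (arches fs) ≡ length (factorsPath fs)
arches-length [] = refl
arches-length (f ∷ fs) = begin
  2 * length (archWord (toArch f) ++ arches fs)
    ≡⟨ cong (2 *_) (length-++ (archWord (toArch f))) ⟩
  2 * (length (archWord (toArch f)) + length (arches fs))
    ≡⟨ *-distribˡ-+ 2 (length (archWord (toArch f))) (length (arches fs)) ⟩
  2 * length (archWord (toArch f)) + 2 * length (arches fs)
    ≡⟨ cong₂ _+_ (factor-length f) (arches-length fs) ⟩
  length (factorPath αW βW γW f) + length (factorsPath fs)
    ≡⟨ sym (length-++ (factorPath αW βW γW f)) ⟩
  length (factorsPath (f ∷ fs)) ∎
  where open ≡-Reasoning

factorsPath-Dyck : ∀ fs → IsDyck (factorsPath fs)
factorsPath-Dyck [] = end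
factorsPath-Dyck ((_ , _ , A , _) ∷ fs) = Dyk-++ (InA.dyck A) (factorsPath-Dyck fs)

first-return-unique : ∀ {h s s′ t t′} → Mot h s → Mot h s′ →
  s ++ D ∷ t ≡ s′ ++ D ∷ t′ → s ≡ s′ × t ≡ t′
first-return-unique end end eq = refl , ∷-injectiveʳ eq
first-return-unique end (up M′) ()
first-return-unique end (hor M′) ()
first-return-unique (up M) end ()
first-return-unique (hor M) end ()
first-return-unique (up M) (up M′) eq with first-return-unique M M′ (∷-injectiveʳ eq)
... | refl , e = refl , e
first-return-unique (down M) (down M′) eq with first-return-unique M M′ (∷-injectiveʳ eq)
... | refl , e = refl , e
first-return-unique (hor M) (hor M′) eq with first-return-unique M M′ (∷-injectiveʳ eq)
... | refl , e = refl , e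

flats-unique : ∀ j j′ {t t′} → replicate j H ++ t ≡ replicate j′ H ++ t′ →
  FirstNotH t → FirstNotH t′ → j ≡ j′ × t ≡ t′
flats-unique zero zero eq _ _ = refl , eq
flats-unique zero (suc j′) refl () _
flats-unique (suc j) zero refl _ ()
flats-unique (suc j) (suc j′) eq x x′ with flats-unique j j′ (∷-injectiveʳ eq) x x′
... | refl , e = refl , e

arches-injective : ∀ fs fs′ → arches fs ≡ arches fs′ → fs ≡ fs′
arches-injective [] [] eq = refl
arches-injective [] (_ ∷ _) ()
arches-injective (_ ∷ _) [] ()
arches-injective (f ∷ fs) (f′ ∷ fs′) eq with toArch f in ef | toArch f′ in ef′
... | arch p M j | arch p′ M′ j′
  with first-return-unique M M′
         (trans (sym (++-assoc p _ (arches fs))) (trans (∷-injectiveʳ eq) (++-assoc p′ _ (arches fs′))))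
... | refl , e with flats-unique j j′ e (arches-FirstNotH fs) (arches-FirstNotH fs′)
... | refl , e′ rewrite Mot-irrelevant M M′ = cong₂ _∷_ f≡f′ (arches-injective fs fs′ e′)
  where
  f≡f′ : f ≡ f′
  f≡f′ = begin
    f                     ≡⟨ sym (fromArch-toArch f) ⟩
    fromArch (toArch f)   ≡⟨ cong fromArch (trans ef (sym ef′)) ⟩
    fromArch (toArch f′)  ≡⟨ fromArch-toArch f′ ⟩
    f′ ∎
    where open ≡-Reasoning

Mot-first-descent : ∀ k h s → Mot (k + suc h) s →
  ∃[ p ] ∃[ t ] s ≡ p ++ D ∷ t × Mot k p × Mot h t
Mot-first-descent zero h (D ∷ s) (down M) = [] , s , refl , end , M
Mot-first-descent zero h (U ∷ s) (up M) with Mot-first-descent 1 h s M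
... | p , t , refl , Mp , Mt = U ∷ p , t , refl , up Mp , Mt
Mot-first-descent zero h (H ∷ s) (hor M) with Mot-first-descent zero h s M
... | p , t , refl , Mp , Mt = H ∷ p , t , refl , hor Mp , Mt
Mot-first-descent (suc k) h (U ∷ s) (up M) with Mot-first-descent (suc (suc k)) h s M
... | p , t , refl , Mp , Mt = U ∷ p , t , refl , up Mp , Mt
Mot-first-descent (suc k) h (D ∷ s) (down M) with Mot-first-descent k h s M
... | p , t , refl , Mp , Mt = D ∷ p , t , refl , down Mp , Mt
Mot-first-descent (suc k) h (H ∷ s) (hor M) with Mot-first-descent (suc k) h s M
... | p , t , refl , Mp , Mt = H ∷ p , t , refl , hor Mp , Mt

strip-flats : ∀ s → Mot 0 s →
  ∃[ j ] ∃[ t ] s ≡ replicate j H ++ t × Mot 0 t × FirstNotH t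
strip-flats [] end = 0 , [] , refl , end , tt
strip-flats (U ∷ s) M = 0 , U ∷ s , refl , M , tt
strip-flats (H ∷ s) (hor M) with strip-flats s M
... | j , t , refl , Mt , x = suc j , t , refl , Mt , x

-- Recursion on a length bound: the remainder after the first arch is a suffix.
arches-surjective-bounded : ∀ bound s → length s ≤ bound → Mot 0 s → FirstNotH s →
  ∃[ fs ] arches fs ≡ s
arches-surjective-bounded bound [] _ _ _ = [] , refl
arches-surjective-bounded (suc bound) (U ∷ s) (s≤s ≤bound) (up M) _
  with Mot-first-descent 0 0 s M
... | p , r , refl , Mp , Mr with strip-flats r Mr
... | j , t , refl , Mt , xt
  with arches-surjective-bounded bound t
         (≤-trans (length-++-≤ʳ t {D ∷ replicate j H}) (≤-trans (length-++-≤ʳ _ {p}) ≤bound)) Mt xt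
... | fs , e = fromArch (arch p Mp j) ∷ fs , (begin
  archWord (toArch (fromArch (arch p Mp j))) ++ arches fs
    ≡⟨ cong₂ (λ a w → archWord a ++ w) (toArch-fromArch (arch p Mp j)) e ⟩
  (U ∷ p ++ D ∷ replicate j H) ++ t
    ≡⟨ cong (U ∷_) (++-assoc p (D ∷ replicate j H) t) ⟩
  U ∷ p ++ D ∷ replicate j H ++ t ∎)
  where open ≡-Reasoning

arches-surjective : ∀ s → Mot 0 s → FirstNotH s → ∃[ fs ] arches fs ≡ s
arches-surjective s = arches-surjective-bounded (length s) s ≤-refl

·-identityˡ : ∀ x → 𝟙 · x ≡ x
·-identityˡ (i , j) = cong (_, j) (ℤP.+-identityˡ i)

·-assoc : ∀ x y z → (x · y) · z ≡ x · (y · z)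
·-assoc (i , j) (k , l) (m , o) = cong₂ _,_ (ℤP.+-assoc i k m) (+-assoc j l o)

mweight-++ : ∀ s t → mweight (s ++ t) ≡ mweight s · mweight t
mweight-++ [] t = sym (·-identityˡ (mweight t))
mweight-++ (U ∷ s) t = mweight-++ s t
mweight-++ (D ∷ s) t = trans (cong (monB ·_) (mweight-++ s t)) (sym (·-assoc monB (mweight s) (mweight t)))
mweight-++ (H ∷ s) t = trans (cong (monA ·_) (mweight-++ s t)) (sym (·-assoc monA (mweight s) (mweight t)))

monAll-ones : ∀ r → monAll αW βW γW (ones r) ≡ mweight (replicate r H)
monAll-ones zero = refl
monAll-ones (suc r) = cong (monA ·_) (monAll-ones r)

γ-arch-weight : ∀ x → x · (monB · 𝟙) ≡ monB · x
γ-arch-weight (i , j) = cong₂ _,_ (ℤ-part i) (ℕ-part j)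
  where
  ℤ-part : ∀ i → i ℤ.+ (+ 0 ℤ.+ + 0) ≡ + 0 ℤ.+ i
  ℤ-part = ℤ-Solver.solve-∀
  ℕ-part : ∀ j → j + (1 + 0) ≡ 1 + j
  ℕ-part = ℕ-Solver.solve-∀

-- w · b · aʲ⁺¹ = (b/a) · w · a · a · aʲ: the β-factor carries one more α than there are h-steps.
β-arch-weight : ∀ x z → x · (monB · (monA · z)) ≡ (monB/A · x) · (monA · (monA · z))
β-arch-weight (i , j) (k , l) = cong₂ _,_ (ℤ-part i k) (ℕ-part j l)
  where
  ℤ-part : ∀ i k → i ℤ.+ (+ 0 ℤ.+ (+ 1 ℤ.+ k)) ≡ (ℤ.- (+ 1) ℤ.+ i) ℤ.+ (+ 1 ℤ.+ (+ 1 ℤ.+ k))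
  ℤ-part = ℤ-Solver.solve-∀
  ℕ-part : ∀ j l → j + (1 + (0 + l)) ≡ (1 + j) + (0 + (0 + l))
  ℕ-part = ℕ-Solver.solve-∀

archWord-weight : ∀ a → mweight (archWord a) ≡ factorMono αW βW γW (fromArch a)
archWord-weight (arch p M zero) = trans (mweight-++ p [ D ]) (γ-arch-weight (mweight p))
archWord-weight (arch p M (suc j)) = begin
  mweight (p ++ D ∷ H ∷ replicate j H)
    ≡⟨ mweight-++ p (D ∷ H ∷ replicate j H) ⟩
  mweight p · (monB · (monA · mweight (replicate j H)))
    ≡⟨ β-arch-weight (mweight p) (mweight (replicate j H)) ⟩
  (monB/A · mweight p) · (monA · (monA · mweight (replicate j H)))
    ≡⟨ cong (λ z → (monB/A · mweight p) · (monA · (monA · z))) (sym (monAll-ones j)) ⟩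
  (monB/A · mweight p) · monAll αW βW γW (ones (suc (suc j))) ∎
  where open ≡-Reasoning

arches-weight : ∀ fs → mweight (arches fs) ≡ monFactors αW βW γW fs
arches-weight [] = refl
arches-weight (f ∷ fs) = begin
  mweight (archWord (toArch f) ++ arches fs)
    ≡⟨ mweight-++ (archWord (toArch f)) (arches fs) ⟩
  mweight (archWord (toArch f)) · mweight (arches fs)
    ≡⟨ cong₂ _·_ (archWord-weight (toArch f)) (arches-weight fs) ⟩
  factorMono αW βW γW (fromArch (toArch f)) · monFactors αW βW γW fs
    ≡⟨ cong (λ g → factorMono αW βW γW g · monFactors αW βW γW fs) (fromArch-toArch f) ⟩
  monFactors αW βW γW (f ∷ fs) ∎
  where open ≡-Reasoning

module Bijection (n : ℕ) where

  𝒱→𝒳 : Copy (𝒱 αW βW γW n) → Copy (𝒳 n)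
  𝒱→𝒳 (_ , len , _ , fs , refl) =
    arches fs , *-cancelˡ-≡ _ _ 2 (trans (arches-length fs) len) , arches-Mot fs , arches-FirstNotH fs

  𝒱→𝒳-injective : (y y′ : Copy (𝒱 αW βW γW n)) → 𝒱→𝒳 y ≡ 𝒱→𝒳 y′ → y ≡ y′
  𝒱→𝒳-injective (_ , l , DP , fs , refl) (_ , l′ , DP′ , fs′ , refl) eq
    with arches-injective fs fs′ (cong (λ (x : Copy (𝒳 n)) → proj₁ x) eq)
  ... | refl rewrite ≡-irrelevant l l′ | Dyk-irrelevant DP DP′ = refl

  𝒳-copy-≡ : ∀ s (l l′ : length s ≡ n) (M M′ : Mot 0 s) (x x′ : FirstNotH s) →
    _≡_ {A = Copy (𝒳 n)} (s , l , M , x) (s , l′ , M′ , x′)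
  𝒳-copy-≡ s l l′ M M′ x x′
    rewrite ≡-irrelevant l l′ | Mot-irrelevant M M′ | FirstNotH-irrelevant s x x′ = refl

  𝒱→𝒳-surjective : (x : Copy (𝒳 n)) → ∃[ y ] 𝒱→𝒳 y ≡ x
  𝒱→𝒳-surjective (s , l , M , x) with arches-surjective s M x
  ... | fs , refl =
    (factorsPath fs , trans (sym (arches-length fs)) (cong (2 *_) l) , factorsPath-Dyck fs , fs , refl) ,
    𝒳-copy-≡ (arches fs) _ l _ M _ x

  𝒱→𝒳-weight : (y : Copy (𝒱 αW βW γW n)) → mono (𝒳 n) (𝒱→𝒳 y) ≡ mono (𝒱 αW βW γW n) y
  𝒱→𝒳-weight (_ , _ , _ , fs , refl) = arches-weight fs

corollary3p2 : (n : ℕ) → 𝒳 n ≅W 𝒱 αW βW γW n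
corollary3p2 n = mk↔ₛ′ 𝒳→𝒱 𝒱→𝒳 (λ y → 𝒱→𝒳-injective _ y (section (𝒱→𝒳 y))) section , weight
  where
  open Bijection n

  𝒳→𝒱 : Copy (𝒳 n) → Copy (𝒱 αW βW γW n)
  𝒳→𝒱 x = proj₁ (𝒱→𝒳-surjective x)

  section : ∀ x → 𝒱→𝒳 (𝒳→𝒱 x) ≡ x
  section x = proj₂ (𝒱→𝒳-surjective x)

  weight : ∀ x → mono (𝒱 αW βW γW n) (𝒳→𝒱 x) ≡ mono (𝒳 n) x
  weight x = trans (sym (𝒱→𝒳-weight (𝒳→𝒱 x))) (cong (mono (𝒳 n)) (section x))
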